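{- Let $\alpha\in\mathbb{N}_0^N$ with $N=\ell(\alpha)+|\alpha|$, $\upsilon=\frac1{N+1}$, $\widetilde{\alpha}_i=\alpha_i-i\upsilon$, and let $w$ be the permutation of $\{1,\ldots,N\}$ with $r(\alpha,w(i))=i$. Fix an integer $n$ with $1\le n\le\alpha_{w(1)}$, let $m:=L(\alpha;w(1),\alpha_{w(1)}+1-n)+1$, and define $\xi_{mk+i}:=\widetilde{\alpha}_{w(i)}-nk$ for $1\le i\le m$, $k\ge0$. Then the sequence $(\xi_i)_{i=1}^N$ is strictly decreasing, and $\xi_{j+1}<\widetilde{\alpha}_{w(j)}$ for all sufficiently large $j\le N$. There is a unique integer $T\ge1$ such that $\widetilde{\alpha}_{w(m+s)}<\xi_{m+s+1}$ for $1\le s<T$ and $\widetilde{\alpha}_{w(m+T)}>\xi_{m+T+1}$ (equality $\widetilde{\alpha}_{w(m+s)}=\xi_{m+s+1}$ never occurs for $s\ge1$).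
   Context: $\mathbb{N}_0=\{0,1,2,\ldots\}$, $|\alpha|=\sum_i\alpha_i$, $\ell(\alpha)=\max\{j:\alpha_j>0\}$ (compositions are padded with trailing zeros up to length $N$). Rank: $r(\alpha,i)=\#\{j:\alpha_j>\alpha_i\}+\#\{j:1\le j\le i,\ \alpha_j=\alpha_i\}$; $i\mapsto r(\alpha,i)$ is a bijection of $\{1,\ldots,N\}$. Leg-length: $L(\alpha;i,j)=\#\{l:l>i,\ j\le\alpha_l\le\alpha_i\}+\#\{l:l<i,\ j\le\alpha_l+1\le\alpha_i\}$ for $1\le i\le\ell(\alpha)$, $1\le j\le\alpha_i$. -}

module Defs where

open import Data.Nat using (ℕ; zero; suc; _+_; _*_; _∸_; _≤_; _<_; _≤?_; _<?_; _≟_; _⊔_)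
open import Data.Nat.DivMod using (_/_; _%_)
import Data.Integer as ℤ
open import Data.List using (List; []; _∷_; applyUpTo; filter; length; foldr; map)
open import Data.Nat.ListAction using (sum)
open import Data.Vec using (Vec; toList)
open import Data.Product using (_×_)
open import Relation.Nullary.Decidable using (_×-dec_)
import Data.Rational as ℚ
open ℚ using (ℚ)

-- Compositions α ∈ ℕ₀^N are vectors `Vec ℕ N`; entries are indexed 1..N
-- as in the paper.  `α ‼ i` is α_i for 1 ≤ i ≤ N (and 0 outside that range).
_‼_ : ∀ {N} → Vec ℕ N → ℕ → ℕ
α ‼ i = go (toList α) i
  where
  go : List ℕ → ℕ → ℕ
  go []       _             = 0
  go (x ∷ xs) zero          = 0
  go (x ∷ xs) (suc zero)    = x
  go (x ∷ xs) (suc (suc k)) = go xs (suc k)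

[_⋯_] : ℕ → ℕ → List ℕ
[ a ⋯ b ] = applyUpTo (λ k → a + k) (suc b ∸ a)

∣_∣ : ∀ {N} → Vec ℕ N → ℕ
∣ α ∣ = sum (toList α)

ℓ : ∀ {N} → Vec ℕ N → ℕ
ℓ {N} α = foldr _⊔_ 0 (filter (λ j → 0 <? α ‼ j) [ 1 ⋯ N ])

rank : ∀ {N} → Vec ℕ N → ℕ → ℕ
rank {N} α i =
  length (filter (λ j → α ‼ i <? α ‼ j) [ 1 ⋯ N ])
  + length (filter (λ j → α ‼ j ≟ α ‼ i) [ 1 ⋯ i ])

leg : ∀ {N} → Vec ℕ N → ℕ → ℕ → ℕ
leg {N} α i j =
  length (filter (λ l → (j ≤? α ‼ l) ×-dec (α ‼ l ≤? α ‼ i)) [ suc i ⋯ N ])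
  + length (filter (λ l → (j ≤? suc (α ‼ l)) ×-dec (suc (α ‼ l) ≤? α ‼ i)) [ 1 ⋯ i ∸ 1 ])

ℕ→ℚ : ℕ → ℚ
ℕ→ℚ k = ℤ.+ k ℚ./ 1

υ : ℕ → ℚ
υ N = ℤ.+ 1 ℚ./ suc N

α̃ : ∀ {N} → Vec ℕ N → ℕ → ℚ
α̃ {N} α i = ℕ→ℚ (α ‼ i) ℚ.- ℕ→ℚ i ℚ.* υ N

-- ξ_{mk+i} = α̃_{w(i)} − n k  for 1 ≤ i ≤ m, k ≥ 0, where m = suc m' ≥ 1.
-- For j ≥ 1 write j − 1 = m k + (i − 1) with 0 ≤ i − 1 < m.
ξ : ∀ {N} → Vec ℕ N → (w : ℕ → ℕ) (n m' : ℕ) → ℕ → ℚ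
ξ α w n m' j =
  α̃ α (w (suc ((j ∸ 1) % suc m'))) ℚ.- ℕ→ℚ (n * ((j ∸ 1) / suc m'))

{-# OPTIONS --safe #-}
module Submission where

open import Defs
open import Data.Nat
open import Data.Nat.Properties
open import Data.Nat.DivMod using (m%n<n; m≡m%n+[m/n]*n; [m+kn]%n≡m%n; m<n⇒m%n≡m)
import Data.Nat.Tactic.RingSolver as ℕ-Solver
open import Data.Integer as ℤ using (ℤ; _⊖_)
import Data.Integer.Properties as ℤ
import Data.Integer.Tactic.RingSolver as ℤ-Solver
open import Data.Rational as ℚ using (ℚ; toℚᵘ)
import Data.Rational.Properties as ℚ
open import Data.Rational.Unnormalised as ℚᵘ using (ℚᵘ; mkℚᵘ; *≡*; _≃_)
import Data.Rational.Unnormalised.Properties as ℚᵘ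
open import Data.Rational.Unnormalised.Solver using (module +-*-Solver)
open import Data.Vec using (Vec; []; _∷_)
open import Data.List using (foldr; applyUpTo; filter; length)
open import Data.List.Membership.Propositional using (_∈_)
open import Data.List.Membership.Propositional.Properties using (∈-filter⁺; ∈-applyUpTo⁺)
open import Data.List.Relation.Unary.Any using (here; there)
open import Data.Product using (Σ; ∃; _×_; _,_; proj₁; proj₂)
open import Data.Sum using (_⊎_; inj₁; inj₂)
open import Data.Empty using (⊥-elim)
open import Function using (_∘_)
open import Relation.Nullary using (Dec; yes; no; ¬_)
open import Relation.Nullary.Decidable using (_×-dec_; _⊎-dec_)
open import Relation.Unary using (Pred; Decidable)
open import Relation.Binary.Core using (Rel)
open import Relation.Binary.Definitions using (Trichotomous; tri<; tri≈; tri>)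
open import Relation.Binary.Consequences using (tri⇒asym; tri⇒dec<)
open import Relation.Binary.PropositionalEquality
open import Algebra.Properties.CommutativeSemigroup +-commutativeSemigroup using (interchange)

-- The rank order is the decreasing order of α̃ (the term −i/(N+1) breaks ties in α), so α̃ ∘ w
-- is strictly decreasing, and a value α̃_x − e determines x since 0 < x/(N+1) < 1.
-- Hence ξ decreases inside each block of m indices; across blocks it decreases because
-- α̃_{w(m)} + n > α̃_{w(1)}: the positions l with α̃_l + n > α̃_{w(1)} form an upward closed set for
-- the rank order containing w(1) and the m − 1 positions counted by the leg-length, so they include
-- w(1), …, w(m). Weighing that set by α_l + 1 and using N = ℓ(α) + |α| gives
-- t (α_{w(t)} + 1) + (m − t)(α_{w(1)} − n + 1) ≤ N for 1 ≤ t ≤ m. For t = 1 this is m < N; writing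
-- N = q m + r and taking t = r + 1 it gives α_{w(t)} < n q, i.e. ξ_{N+1} < α̃_{w(N)}. So ξ_{m+s+1}
-- eventually drops below α̃_{w(m+s)}, T is the first such s, and there are no ties because
-- ξ_{m+s+1} = α̃_{w(i)} − n k with i ≤ m < m + s.

-- Finite sums and indicators

∑ : ℕ → (ℕ → ℕ) → ℕ
∑ zero    g = 0
∑ (suc n) g = g 0 + ∑ n (g ∘ suc)

∑-cong : ∀ n {g h} → (∀ k → k < n → g k ≡ h k) → ∑ n g ≡ ∑ n h
∑-cong zero    _  = refl
∑-cong (suc n) eq = cong₂ _+_ (eq 0 z<s) (∑-cong n (λ k → eq (suc k) ∘ s<s))

∑-mono-≤ : ∀ n {g h} → (∀ k → k < n → g k ≤ h k) → ∑ n g ≤ ∑ n h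
∑-mono-≤ zero    _  = z≤n
∑-mono-≤ (suc n) le = +-mono-≤ (le 0 z<s) (∑-mono-≤ n (λ k → le (suc k) ∘ s<s))

∑-mono-< : ∀ n {g h} → (∀ k → k < n → g k ≤ h k) → ∀ {k₀} → k₀ < n → g k₀ < h k₀ → ∑ n g < ∑ n h
∑-mono-< (suc n) le {zero}   _          lt = +-mono-<-≤ lt (∑-mono-≤ n (λ k → le (suc k) ∘ s<s))
∑-mono-< (suc n) le {suc k₀} (s<s k₀<n) lt = +-mono-≤-< (le 0 z<s) (∑-mono-< n (λ k → le (suc k) ∘ s<s) k₀<n lt)

∑-+ : ∀ n g h → ∑ n (λ k → g k + h k) ≡ ∑ n g + ∑ n h
∑-+ zero    g h = refl
∑-+ (suc n) g h = trans (cong (g 0 + h 0 +_) (∑-+ n (g ∘ suc) (h ∘ suc))) (interchange (g 0) (h 0) _ _)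

∑-*ʳ : ∀ n g c → ∑ n (λ k → g k * c) ≡ ∑ n g * c
∑-*ʳ zero    g c = refl
∑-*ʳ (suc n) g c = trans (cong (g 0 * c +_) (∑-*ʳ n (g ∘ suc) c)) (sym (*-distribʳ-+ c (g 0) _))

∑-split : ∀ a b g → ∑ (a + b) g ≡ ∑ a g + ∑ b (λ k → g (a + k))
∑-split zero    b g = refl
∑-split (suc a) b g = trans (cong (g 0 +_) (∑-split a b (g ∘ suc))) (sym (+-assoc (g 0) _ _))

∑-zero : ∀ n {g} → (∀ k → g k ≡ 0) → ∑ n g ≡ 0
∑-zero zero    _ = refl
∑-zero (suc n) z rewrite z 0 = ∑-zero n (z ∘ suc)

∑-vanishing-tail : ∀ {a n} g → a ≤ n → (∀ k → a ≤ k → g k ≡ 0) → ∑ n g ≡ ∑ a g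
∑-vanishing-tail {a} {n} g a≤n z = begin
  ∑ n g                              ≡⟨ cong (λ n → ∑ n g) (m+[n∸m]≡n a≤n) ⟨
  ∑ (a + (n ∸ a)) g                  ≡⟨ ∑-split a (n ∸ a) g ⟩
  ∑ a g + ∑ (n ∸ a) (λ k → g (a + k)) ≡⟨ cong (∑ a g +_) (∑-zero (n ∸ a) (λ k → z (a + k) (m≤m+n a k))) ⟩
  ∑ a g + 0                          ≡⟨ +-identityʳ _ ⟩
  ∑ a g                              ∎
  where open ≡-Reasoning

∑[≤1]≤n : ∀ n {g} → (∀ k → g k ≤ 1) → ∑ n g ≤ n
∑[≤1]≤n zero    _  = z≤n
∑[≤1]≤n (suc n) le = +-mono-≤ (le 0) (∑[≤1]≤n n (le ∘ suc))

𝟙 : ∀ {p} {P : Set p} → Dec P → ℕ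
𝟙 (yes _) = 1
𝟙 (no _)  = 0

𝟙-yes : ∀ {p} {P : Set p} → P → (d : Dec P) → 𝟙 d ≡ 1
𝟙-yes _ (yes _) = refl
𝟙-yes x (no ¬x) = ⊥-elim (¬x x)

𝟙-no : ∀ {p} {P : Set p} → ¬ P → (d : Dec P) → 𝟙 d ≡ 0
𝟙-no ¬x (yes x) = ⊥-elim (¬x x)
𝟙-no _  (no _)  = refl

𝟙≤1 : ∀ {p} {P : Set p} (d : Dec P) → 𝟙 d ≤ 1
𝟙≤1 (yes _) = ≤-refl
𝟙≤1 (no _)  = z≤n

𝟙-mono : ∀ {p q} {P : Set p} {Q : Set q} → (P → Q) → (d : Dec P) (e : Dec Q) → 𝟙 d ≤ 𝟙 e
𝟙-mono f (yes x) e = ≤-reflexive (sym (𝟙-yes (f x) e))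
𝟙-mono f (no _)  e = z≤n

𝟙-⊎ : ∀ {p q} {P : Set p} {Q : Set q} (d : Dec P) (e : Dec Q) → (P → ¬ Q) → 𝟙 (d ⊎-dec e) ≡ 𝟙 d + 𝟙 e
𝟙-⊎ (yes x) (yes y) disj = ⊥-elim (disj x y)
𝟙-⊎ (yes _) (no _)  _    = refl
𝟙-⊎ (no _)  (yes _) _    = refl
𝟙-⊎ (no _)  (no _)  _    = refl

𝟙-×-yes : ∀ {p q} {P : Set p} {Q : Set q} (d : Dec P) (e : Dec Q) → Q → 𝟙 (d ×-dec e) ≡ 𝟙 d
𝟙-×-yes (yes _) (yes _) _ = refl
𝟙-×-yes (yes _) (no ¬y) y = ⊥-elim (¬y y)
𝟙-×-yes (no _)  _       _ = refl

length-filter-applyUpTo : ∀ {p} {P : Pred ℕ p} (P? : Decidable P) f n →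
                          length (filter P? (applyUpTo f n)) ≡ ∑ n (λ k → 𝟙 (P? (f k)))
length-filter-applyUpTo P? f zero = refl
length-filter-applyUpTo P? f (suc n) with P? (f 0)
... | yes _ = cong suc (length-filter-applyUpTo P? (f ∘ suc) n)
... | no _  = length-filter-applyUpTo P? (f ∘ suc) n

lex-+ʳ : ∀ {a b p q} e → a < b ⊎ (a ≡ b × q < p) → a + e < b + e ⊎ (a + e ≡ b + e × q < p)
lex-+ʳ e (inj₁ a<b)        = inj₁ (+-monoˡ-< e a<b)
lex-+ʳ e (inj₂ (a≡b , q<p)) = inj₂ (cong (_+ e) a≡b , q<p)

-- With N = r + q m and m = (r + 1) + b, this turns the weight bound at t = r + 1 into α_{w(t)} < n q.
quotient-bound : ∀ {n M v q r b} → 1 ≤ n → v ≤ M →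
                 suc r * (v + 1) + b * suc (M ∸ n) ≤ r + q * (suc r + b) → v < n * q
quotient-bound {n} {M} {v} {q} {r} {b} 1≤n v≤M total = ≰⇒> impossible
  where
  instance _ = >-nonZero 1≤n
  impossible : ¬ n * q ≤ v
  impossible nq≤v = <-irrefl refl (begin-strict
    r + q * (suc r + b)                    <⟨ n<1+n _ ⟩
    suc (r + q * (suc r + b))              ≡⟨ regroup r q b ⟩
    suc r * (q + 1) + b * q
      ≤⟨ +-mono-≤ (*-monoʳ-≤ (suc r) (+-monoˡ-≤ 1 q≤v)) (*-monoʳ-≤ b (q≤K q (≤-trans nq≤v v≤M))) ⟩
    suc r * (v + 1) + b * suc (M ∸ n)       ≤⟨ total ⟩
    r + q * (suc r + b)                    ∎)
    where
    open ≤-Reasoning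
    q≤v : q ≤ v
    q≤v = ≤-trans (m≤n*m q n) nq≤v
    regroup : ∀ r q b → suc (r + q * (suc r + b)) ≡ suc r * (q + 1) + b * q
    regroup = ℕ-Solver.solve-∀
    q≤K : ∀ q → n * q ≤ M → q ≤ suc (M ∸ n)
    q≤K zero    _     = z≤n
    q≤K (suc p) np≤M = s≤s (begin
      p                ≤⟨ m≤n*m p n ⟩
      n * p            ≡⟨ m+n∸m≡n n (n * p) ⟨
      n + n * p ∸ n    ≡⟨ cong (_∸ n) (*-suc n p) ⟨
      n * suc p ∸ n    ≤⟨ ∸-monoˡ-≤ n np≤M ⟩
      M ∸ n            ∎)

module _ {d : ℕ} .{{_ : NonZero d}} where

  %-/-unique : ∀ {j r k} → r < d → j ≡ r + k * d → j % d ≡ r × j / d ≡ k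
  %-/-unique {j} {r} {k} r<d j≡ = j%d≡r , *-cancelʳ-≡ (j / d) k d (+-cancelˡ-≡ r _ _ (begin
    r + j / d * d       ≡⟨ cong (_+ j / d * d) j%d≡r ⟨
    j % d + j / d * d   ≡⟨ m≡m%n+[m/n]*n j d ⟨
    j                   ≡⟨ j≡ ⟩
    r + k * d           ∎))
    where
    open ≡-Reasoning
    j%d≡r : j % d ≡ r
    j%d≡r = trans (cong (_% d) j≡) (trans ([m+kn]%n≡m%n r k d) (m<n⇒m%n≡m r<d))

  suc-%-/-inner : ∀ j → suc (j % d) < d → suc j % d ≡ suc (j % d) × suc j / d ≡ j / d
  suc-%-/-inner j lt = %-/-unique lt (cong suc (m≡m%n+[m/n]*n j d))

  suc-%-/-wrap : ∀ j → suc (j % d) ≡ d → suc j % d ≡ 0 × suc j / d ≡ suc (j / d)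
  suc-%-/-wrap j eq = %-/-unique (>-nonZero⁻¹ d) (trans (cong suc (m≡m%n+[m/n]*n j d)) (cong (_+ j / d * d) eq))

-- Least witnesses and first crossings

least-witness : ∀ {p} {P : Pred ℕ p} → Decidable P → ∀ {K} → P K →
                Σ ℕ λ T → T ≤ K × P T × (∀ s → s < T → ¬ P s)
least-witness P? {zero} PK = 0 , z≤n , PK , λ _ ()
least-witness P? {suc K} PK with P? 0
... | yes P0 = 0 , z≤n , P0 , λ _ ()
... | no ¬P0 with least-witness (λ s → P? (suc s)) PK
...   | T , T≤K , PT , minimal = suc T , s≤s T≤K , PT , λ where
          zero    _           → ¬P0
          (suc s) (s<s s<T)   → minimal s s<T

module _ {a r} {A : Set a} {_≺_ : Rel A r} (compare : Trichotomous _≡_ _≺_) where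

  first-crossing : ∀ (f g : ℕ → A) {K} → 1 ≤ K → g K ≺ f K → (∀ s → 1 ≤ s → s ≤ K → f s ≢ g s) →
    Σ ℕ λ T → ((1 ≤ T) × (T ≤ K) × (∀ s → 1 ≤ s → s < T → f s ≺ g s) × (g T ≺ f T))
            × (∀ T′ → 1 ≤ T′ → (∀ s → 1 ≤ s → s < T′ → f s ≺ g s) → g T′ ≺ f T′ → T′ ≡ T)
  first-crossing f g {suc K} _ crossed untied
    with least-witness (λ s → tri⇒dec< compare (g (suc s)) (f (suc s))) crossed
  ... | T-1 , T-1≤K , crossT , minimal = suc T-1 , (s≤s z≤n , s≤s T-1≤K , below , crossT) , unique
    where
    below : ∀ s → 1 ≤ s → s < suc T-1 → f s ≺ g s
    below (suc s) _ (s<s s<T) with compare (f (suc s)) (g (suc s))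
    ... | tri< lt _ _ = lt
    ... | tri≈ _ eq _ = ⊥-elim (untied (suc s) (s≤s z≤n) (s≤s (≤-trans (<⇒≤ s<T) T-1≤K)) eq)
    ... | tri> _ _ gt = ⊥-elim (minimal s s<T gt)
    unique : ∀ T′ → 1 ≤ T′ → (∀ s → 1 ≤ s → s < T′ → f s ≺ g s) → g T′ ≺ f T′ → T′ ≡ suc T-1
    unique (suc T′-1) _ belowT′ crossT′ with <-cmp T′-1 T-1
    ... | tri< lt _ _ = ⊥-elim (minimal T′-1 lt crossT′)
    ... | tri≈ _ eq _ = cong suc eq
    ... | tri> _ _ gt = ⊥-elim (tri⇒asym compare (belowT′ (suc T-1) (s≤s z≤n) (s≤s gt)) crossT)

-- Rationals a − p/(N+1) − e

-- α̃ α x ℚ.- ℕ→ℚ e unfolds to perturbed N (α ‼ x) x e.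
perturbed : ℕ → ℕ → ℕ → ℕ → ℚ
perturbed N a p e = (ℕ→ℚ a ℚ.- ℕ→ℚ p ℚ.* υ N) ℚ.- ℕ→ℚ e

ι : ℤ → ℚᵘ
ι z = mkℚᵘ z 0

toℚᵘ-ℕ→ℚ : ∀ k → toℚᵘ (ℕ→ℚ k) ≃ ι (ℤ.+ k)
toℚᵘ-ℕ→ℚ k = ℚ.toℚᵘ-fromℚᵘ (ι (ℤ.+ k))

toℚᵘ-υ : ∀ N → toℚᵘ (υ N) ≃ mkℚᵘ (ℤ.+ 1) N
toℚᵘ-υ N = ℚ.toℚᵘ-fromℚᵘ (mkℚᵘ (ℤ.+ 1) N)

toℚᵘ-homo-− : ∀ x y → toℚᵘ (x ℚ.- y) ≃ toℚᵘ x ℚᵘ.- toℚᵘ y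
toℚᵘ-homo-− x y = ℚᵘ.≃-trans (ℚ.toℚᵘ-homo-+ x (ℚ.- y)) (ℚᵘ.+-congʳ (toℚᵘ x) (ℚ.toℚᵘ-homo‿- y))

υ*[1+N]≃1 : ∀ N → mkℚᵘ (ℤ.+ 1) N ℚᵘ.* ι (ℤ.+ suc N) ≃ ℚᵘ.1ℚᵘ
υ*[1+N]≃1 N = *≡* (begin
  ℤ.+ 1 ℤ.* ℤ.+ suc N ℤ.* ℤ.+ 1   ≡⟨ ℤ.*-identityʳ _ ⟩
  ℤ.+ 1 ℤ.* ℤ.+ suc N           ≡⟨ ℤ.*-identityˡ _ ⟩
  ℤ.+ suc N                   ≡⟨ cong ℤ.+_ (*-identityʳ (suc N)) ⟨
  ℤ.+ (suc N * 1)             ≡⟨ ℤ.*-identityˡ _ ⟨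
  ℤ.+ 1 ℤ.* ℤ.+ (suc N * 1)     ∎)
  where open ≡-Reasoning

toℚᵘ-perturbed : ∀ N a p e →
  toℚᵘ (perturbed N a p e) ℚᵘ.* ι (ℤ.+ suc N) ≃ ι ((ℤ.+ a ℤ.- ℤ.+ e) ℤ.* ℤ.+ suc N ℤ.- ℤ.+ p)
toℚᵘ-perturbed N a p e = begin
  toℚᵘ (perturbed N a p e) ℚᵘ.* C
    ≈⟨ ℚᵘ.*-congʳ unfold ⟩
  ((A ℚᵘ.- P ℚᵘ.* u) ℚᵘ.- E) ℚᵘ.* C
    ≈⟨ distrib A P E C u ⟩
  (A ℚᵘ.* C ℚᵘ.- P ℚᵘ.* (u ℚᵘ.* C)) ℚᵘ.- E ℚᵘ.* C
    ≈⟨ ℚᵘ.+-congˡ (ℚᵘ.- (E ℚᵘ.* C)) (ℚᵘ.+-congʳ (A ℚᵘ.* C) (ℚᵘ.-‿cong (ℚᵘ.*-congˡ {P} (υ*[1+N]≃1 N)))) ⟩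
  (A ℚᵘ.* C ℚᵘ.- P ℚᵘ.* ℚᵘ.1ℚᵘ) ℚᵘ.- E ℚᵘ.* C
    ≈⟨ *≡* (integral (ℤ.+ a) (ℤ.+ e) (ℤ.+ p) (ℤ.+ suc N)) ⟩
  ι ((ℤ.+ a ℤ.- ℤ.+ e) ℤ.* ℤ.+ suc N ℤ.- ℤ.+ p) ∎
  where
  open ℚᵘ.≃-Reasoning
  A = ι (ℤ.+ a); P = ι (ℤ.+ p); E = ι (ℤ.+ e); C = ι (ℤ.+ suc N); u = mkℚᵘ (ℤ.+ 1) N
  unfold : toℚᵘ (perturbed N a p e) ≃ (A ℚᵘ.- P ℚᵘ.* u) ℚᵘ.- E
  unfold = ℚᵘ.≃-trans (toℚᵘ-homo-− (ℕ→ℚ a ℚ.- ℕ→ℚ p ℚ.* υ N) (ℕ→ℚ e))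
    (ℚᵘ.+-cong (ℚᵘ.≃-trans (toℚᵘ-homo-− (ℕ→ℚ a) (ℕ→ℚ p ℚ.* υ N))
                 (ℚᵘ.+-cong (toℚᵘ-ℕ→ℚ a)
                   (ℚᵘ.-‿cong (ℚᵘ.≃-trans (ℚ.toℚᵘ-homo-* (ℕ→ℚ p) (υ N)) (ℚᵘ.*-cong (toℚᵘ-ℕ→ℚ p) (toℚᵘ-υ N))))))
               (ℚᵘ.-‿cong (toℚᵘ-ℕ→ℚ e)))
  distrib : ∀ A P E C u → ((A ℚᵘ.- P ℚᵘ.* u) ℚᵘ.- E) ℚᵘ.* C ≃ (A ℚᵘ.* C ℚᵘ.- P ℚᵘ.* (u ℚᵘ.* C)) ℚᵘ.- E ℚᵘ.* C
  distrib = +-*-Solver.solve 5 (λ A P E C u → ((A :- P :* u) :- E) :* C := (A :* C :- P :* (u :* C)) :- E :* C) ℚᵘ.≃-refl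
    where open +-*-Solver
  -- The left-hand side is the cross product ℚᵘ computes from the previous line, all denominators being 1.
  integral : ∀ a e p c → (((a ℤ.* c) ℤ.* ℤ.+ 1 ℤ.+ (ℤ.- (p ℤ.* ℤ.+ 1)) ℤ.* ℤ.+ 1) ℤ.* ℤ.+ 1 ℤ.+ (ℤ.- (e ℤ.* c)) ℤ.* ℤ.+ 1) ℤ.* ℤ.+ 1
                          ≡ ((a ℤ.- e) ℤ.* c ℤ.- p) ℤ.* ℤ.+ 1
  integral = ℤ-Solver.solve-∀

⊖-<-⊖ : ∀ {m n m′ n′} → m + n′ < m′ + n → m ⊖ n ℤ.< m′ ⊖ n′
⊖-<-⊖ {m} {n} {m′} {n′} lt = begin-strict
  m ⊖ n                 ≡⟨ ℤ.+-cancelˡ-⊖ n′ m n ⟨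
  (n′ + m) ⊖ (n′ + n)   <⟨ ℤ.⊖-monoˡ-< (n′ + n) (subst₂ _<_ (+-comm m n′) (+-comm m′ n) lt) ⟩
  (n + m′) ⊖ (n′ + n)   ≡⟨ cong ((n + m′) ⊖_) (+-comm n′ n) ⟩
  (n + m′) ⊖ (n + n′)   ≡⟨ ℤ.+-cancelˡ-⊖ n m′ n′ ⟩
  m′ ⊖ n′               ∎
  where open ℤ.≤-Reasoning

lex⇒*+-< : ∀ {x y p q c} → x < y ⊎ (x ≡ y × q < p) → q < c → x * c + q < y * c + p
lex⇒*+-< {x} {y} {p} {q} {c} (inj₁ x<y) q<c = begin-strict
  x * c + q   <⟨ +-monoʳ-< (x * c) q<c ⟩
  x * c + c   ≡⟨ +-comm (x * c) c ⟩
  suc x * c   ≤⟨ *-monoˡ-≤ c x<y ⟩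
  y * c       ≤⟨ m≤m+n (y * c) p ⟩
  y * c + p   ∎
  where open ≤-Reasoning
lex⇒*+-< {x} (inj₂ (refl , q<p)) _ = +-monoʳ-< (x * _) q<p

scaled : ℕ → ℕ → ℕ → ℕ → ℤ
scaled N a p e = (ℤ.+ a ℤ.- ℤ.+ e) ℤ.* ℤ.+ suc N ℤ.- ℤ.+ p

scaled≡⊖ : ∀ N a p e → scaled N a p e ≡ (a * suc N) ⊖ (e * suc N + p)
scaled≡⊖ N a p e = begin
  (ℤ.+ a ℤ.- ℤ.+ e) ℤ.* ℤ.+ c ℤ.- ℤ.+ p       ≡⟨ expand (ℤ.+ a) (ℤ.+ e) (ℤ.+ p) (ℤ.+ c) ⟩
  ℤ.+ a ℤ.* ℤ.+ c ℤ.- (ℤ.+ e ℤ.* ℤ.+ c ℤ.+ ℤ.+ p)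
    ≡⟨ cong₂ (λ x y → x ℤ.- y) (ℤ.pos-* a c) (trans (ℤ.pos-+ (e * c) p) (cong (ℤ._+ ℤ.+ p) (ℤ.pos-* e c))) ⟨
  ℤ.+ (a * c) ℤ.- ℤ.+ (e * c + p)          ≡⟨ ℤ.m-n≡m⊖n (a * c) (e * c + p) ⟩
  (a * c) ⊖ (e * c + p)               ∎
  where
  open ≡-Reasoning
  c = suc N
  expand : ∀ a e p c → (a ℤ.- e) ℤ.* c ℤ.- p ≡ a ℤ.* c ℤ.- (e ℤ.* c ℤ.+ p)
  expand = ℤ-Solver.solve-∀

scaled-< : ∀ N a p e a′ p′ e′ → p′ ≤ N → a + e′ < a′ + e ⊎ (a + e′ ≡ a′ + e × p′ < p) →
           scaled N a p e ℤ.< scaled N a′ p′ e′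
scaled-< N a p e a′ p′ e′ p′≤N lex = subst₂ ℤ._<_ (sym (scaled≡⊖ N a p e)) (sym (scaled≡⊖ N a′ p′ e′))
  (⊖-<-⊖ {a * suc N} {e * suc N + p} {a′ * suc N} {e′ * suc N + p′}
    (subst₂ _<_ (regroup a e′ p′ (suc N)) (regroup a′ e p (suc N)) (lex⇒*+-< lex (s≤s p′≤N))))
  where
  regroup : ∀ a e p c → (a + e) * c + p ≡ a * c + (e * c + p)
  regroup = ℕ-Solver.solve-∀

ι-mono-< : ∀ {x y} → x ℤ.< y → ι x ℚᵘ.< ι y
ι-mono-< {x} {y} x<y = ℚᵘ.*<* (subst₂ ℤ._<_ (sym (ℤ.*-identityʳ x)) (sym (ℤ.*-identityʳ y)) x<y)

perturbed-< : ∀ N a p e a′ p′ e′ → p′ ≤ N → a + e′ < a′ + e ⊎ (a + e′ ≡ a′ + e × p′ < p) →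
              perturbed N a p e ℚ.< perturbed N a′ p′ e′
perturbed-< N a p e a′ p′ e′ p′≤N lex = ℚ.toℚᵘ-cancel-< (ℚᵘ.*-cancelʳ-<-nonNeg (ι (ℤ.+ suc N))
  (ℚᵘ.<-respʳ-≃ (ℚᵘ.≃-sym (toℚᵘ-perturbed N a′ p′ e′)) (ℚᵘ.<-respˡ-≃ (ℚᵘ.≃-sym (toℚᵘ-perturbed N a p e))
    (ι-mono-< (scaled-< N a p e a′ p′ e′ p′≤N lex)))))

perturbed-injective : ∀ N a p e a′ p′ e′ → p ≤ N → p′ ≤ N →
                      perturbed N a p e ≡ perturbed N a′ p′ e′ → p ≡ p′
perturbed-injective N a p e a′ p′ e′ p≤N p′≤N eq with <-cmp (a + e′) (a′ + e)
... | tri< lt _ _ = ⊥-elim (ℚ.<-irrefl eq (perturbed-< N a p e a′ p′ e′ p′≤N (inj₁ lt)))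
... | tri> _ _ gt = ⊥-elim (ℚ.<-irrefl (sym eq) (perturbed-< N a′ p′ e′ a p e p≤N (inj₁ gt)))
... | tri≈ _ same _ with <-cmp p p′
...   | tri< lt _ _ = ⊥-elim (ℚ.<-irrefl (sym eq) (perturbed-< N a′ p′ e′ a p e p≤N (inj₂ (sym same , lt))))
...   | tri≈ _ p≡p′ _ = p≡p′
...   | tri> _ _ gt = ⊥-elim (ℚ.<-irrefl eq (perturbed-< N a p e a′ p′ e′ p′≤N (inj₂ (same , gt))))

-- Compositions and the rank order

‼-pos⇒inRange : ∀ {N} (α : Vec ℕ N) x → 0 < α ‼ x → 1 ≤ x × x ≤ N
‼-pos⇒inRange (a ∷ as) 1             _   = s≤s z≤n , s≤s z≤n
‼-pos⇒inRange (a ∷ as) (suc (suc x)) pos = s≤s z≤n , s≤s (proj₂ (‼-pos⇒inRange as (suc x) pos))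

∈⇒≤foldr-⊔ : ∀ {x xs} → x ∈ xs → x ≤ foldr _⊔_ 0 xs
∈⇒≤foldr-⊔ (here refl) = m≤m⊔n _ _
∈⇒≤foldr-⊔ (there x∈xs) = ≤-trans (∈⇒≤foldr-⊔ x∈xs) (m≤n⊔m _ _)

‼-pos⇒≤ℓ : ∀ {N} (α : Vec ℕ N) {l} → 1 ≤ l → l ≤ N → 0 < α ‼ l → l ≤ ℓ α
‼-pos⇒≤ℓ α {suc l} _ l<N pos = ∈⇒≤foldr-⊔ (∈-filter⁺ (λ j → 0 <? α ‼ j) (∈-applyUpTo⁺ suc l<N) pos)

∣∣≡∑ : ∀ {N} (α : Vec ℕ N) → ∣ α ∣ ≡ ∑ N (λ k → α ‼ suc k)
∣∣≡∑ []       = refl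
∣∣≡∑ (a ∷ as) = cong (a +_) (∣∣≡∑ as)

∑𝟙[1+k≤L]≤L : ∀ n L → ∑ n (λ k → 𝟙 (suc k ≤? L)) ≤ L
∑𝟙[1+k≤L]≤L n L with ≤-total n L
... | inj₁ n≤L = ≤-trans (∑[≤1]≤n n (λ k → 𝟙≤1 (suc k ≤? L))) n≤L
... | inj₂ L≤n = begin
  ∑ n g  ≡⟨ ∑-vanishing-tail g L≤n (λ k L≤k → 𝟙-no (λ k<L → <-irrefl refl (<-≤-trans k<L L≤k)) (suc k ≤? L)) ⟩
  ∑ L g  ≤⟨ ∑[≤1]≤n L (λ k → 𝟙≤1 (suc k ≤? L)) ⟩
  L      ∎
  where
  open ≤-Reasoning
  g : ℕ → ℕ
  g k = 𝟙 (suc k ≤? L)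

module PositionOrder {N : ℕ} (α : Vec ℕ N) where

  infix 4 _≻_ _⪰_ _⪰?_ _≻?_

  -- p ≻ q says α̃_p > α̃_q: larger entry, ties broken by smaller index.
  _≻_ : ℕ → ℕ → Set
  p ≻ q = α ‼ q < α ‼ p ⊎ (α ‼ q ≡ α ‼ p × p < q)

  _⪰_ : ℕ → ℕ → Set
  p ⪰ q = α ‼ q < α ‼ p ⊎ (α ‼ p ≡ α ‼ q × p ≤ q)

  _≻?_ : ∀ p q → Dec (p ≻ q)
  p ≻? q = (α ‼ q <? α ‼ p) ⊎-dec ((α ‼ q ≟ α ‼ p) ×-dec (p <? q))

  _⪰?_ : ∀ p q → Dec (p ⪰ q)
  p ⪰? q = (α ‼ q <? α ‼ p) ⊎-dec ((α ‼ p ≟ α ‼ q) ×-dec (p ≤? q))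

  ⪰-refl : ∀ p → p ⪰ p
  ⪰-refl p = inj₂ (refl , ≤-refl)

  ⪰-trans : ∀ {p q r} → p ⪰ q → q ⪰ r → p ⪰ r
  ⪰-trans (inj₁ q<p)        (inj₁ r<q)        = inj₁ (<-trans r<q q<p)
  ⪰-trans (inj₁ q<p)        (inj₂ (q≡r , _))  = inj₁ (subst (_< _) q≡r q<p)
  ⪰-trans (inj₂ (p≡q , _))  (inj₁ r<q)        = inj₁ (subst (_ <_) (sym p≡q) r<q)
  ⪰-trans (inj₂ (p≡q , p≤q)) (inj₂ (q≡r , q≤r)) = inj₂ (trans p≡q q≡r , ≤-trans p≤q q≤r)

  ⪰-entry : ∀ {p q} → p ⪰ q → α ‼ q ≤ α ‼ p
  ⪰-entry (inj₁ q<p)       = <⇒≤ q<p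
  ⪰-entry (inj₂ (p≡q , _)) = ≤-reflexive (sym p≡q)

  ≻⇒⪰ : ∀ {p q} → p ≻ q → p ⪰ q
  ≻⇒⪰ (inj₁ q<p)         = inj₁ q<p
  ≻⇒⪰ (inj₂ (q≡p , p<q)) = inj₂ (sym q≡p , <⇒≤ p<q)

  ¬≻⇒⪰ : ∀ {p q} → ¬ p ≻ q → q ⪰ p
  ¬≻⇒⪰ {p} {q} p⊁q with <-cmp (α ‼ p) (α ‼ q)
  ... | tri< p<q _ _ = inj₁ p<q
  ... | tri> _ _ q<p = ⊥-elim (p⊁q (inj₁ q<p))
  ... | tri≈ _ p≡q _ = inj₂ (sym p≡q , ≮⇒≥ (λ p<q → p⊁q (inj₂ (sym p≡q , p<q))))

  ¬⪰⇒≻ : ∀ {p q} → ¬ p ⪰ q → q ≻ p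
  ¬⪰⇒≻ {p} {q} p⋡q with <-cmp (α ‼ p) (α ‼ q)
  ... | tri< p<q _ _ = inj₁ p<q
  ... | tri> _ _ q<p = ⊥-elim (p⋡q (inj₁ q<p))
  ... | tri≈ _ p≡q _ = inj₂ (p≡q , ≰⇒> (λ p≤q → p⋡q (inj₂ (p≡q , p≤q))))

  count : ∀ {q} {Q : Pred ℕ q} → Decidable Q → ℕ
  count Q? = ∑ N (𝟙 ∘ Q? ∘ suc)

  rank≡count : ∀ p → p ≤ N → rank α p ≡ count (_⪰? p)
  rank≡count p p≤N = begin
    rank α p
      ≡⟨ cong₂ _+_ (length-filter-applyUpTo (λ l → A p <? A l) suc N) (length-filter-applyUpTo (λ l → A l ≟ A p) suc p) ⟩
    ∑ N (λ k → 𝟙 (A p <? A (suc k))) + ∑ p (λ k → 𝟙 (A (suc k) ≟ A p))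
      ≡⟨ cong (∑ N (λ k → 𝟙 (A p <? A (suc k))) +_) tied ⟩
    ∑ N (λ k → 𝟙 (A p <? A (suc k))) + ∑ N tie
      ≡⟨ ∑-+ N _ tie ⟨
    ∑ N (λ k → 𝟙 (A p <? A (suc k)) + tie k)
      ≡⟨ ∑-cong N (λ k _ → 𝟙-⊎ (A p <? A (suc k)) ((A (suc k) ≟ A p) ×-dec (suc k ≤? p)) disjoint) ⟨
    count (_⪰? p) ∎
    where
    open ≡-Reasoning
    A = α ‼_
    disjoint : ∀ {l} → A p < A l → ¬ (A l ≡ A p × l ≤ p)
    disjoint p<l (l≡p , _) = <-irrefl (sym l≡p) p<l
    tie : ℕ → ℕ
    tie k = 𝟙 ((A (suc k) ≟ A p) ×-dec (suc k ≤? p))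
    tied : ∑ p (λ k → 𝟙 (A (suc k) ≟ A p)) ≡ ∑ N tie
    tied = begin
      ∑ p (λ k → 𝟙 (A (suc k) ≟ A p)) ≡⟨ ∑-cong p (λ k k<p → 𝟙-×-yes (A (suc k) ≟ A p) (suc k ≤? p) k<p) ⟨
      ∑ p tie                          ≡⟨ ∑-vanishing-tail tie p≤N (λ k p≤k → 𝟙-no (λ (_ , k<p) → <⇒≱ k<p p≤k) _) ⟨
      ∑ N tie                          ∎

  count≤N : ∀ {q} {Q : Pred ℕ q} (Q? : Decidable Q) → count Q? ≤ N
  count≤N Q? = ∑[≤1]≤n N (λ k → 𝟙≤1 (Q? (suc k)))

  count-splitAt : ∀ {q} {Q : Pred ℕ q} (Q? : Decidable Q) {p} → 1 ≤ p → p ≤ N →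
                  count Q? ≡ ∑ (p ∸ 1) (𝟙 ∘ Q? ∘ suc) + (𝟙 (Q? p) + ∑ (N ∸ p) (λ k → 𝟙 (Q? (suc p + k))))
  count-splitAt Q? {suc v} _ p≤N = begin
    ∑ N g                                                   ≡⟨ cong (λ n → ∑ n g) N≡ ⟩
    ∑ (v + suc (N ∸ suc v)) g                               ≡⟨ ∑-split v (suc (N ∸ suc v)) g ⟩
    ∑ v g + (g (v + 0) + ∑ (N ∸ suc v) (λ k → g (v + suc k)))
      ≡⟨ cong (λ x → ∑ v g + (g x + ∑ (N ∸ suc v) (λ k → g (v + suc k)))) (+-identityʳ v) ⟩
    ∑ v g + (g v + ∑ (N ∸ suc v) (λ k → g (v + suc k)))
      ≡⟨ cong (λ x → ∑ v g + (g v + x)) (∑-cong (N ∸ suc v) (λ k _ → cong (𝟙 ∘ Q? ∘ suc) (+-suc v k))) ⟩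
    ∑ v g + (g v + ∑ (N ∸ suc v) (λ k → g (suc v + k)))     ∎
    where
    open ≡-Reasoning
    g = 𝟙 ∘ Q? ∘ suc
    N≡ : N ≡ v + suc (N ∸ suc v)
    N≡ = sym (trans (+-suc v (N ∸ suc v)) (m+[n∸m]≡n p≤N))

  weight : ∀ {q} {Q : Pred ℕ q} → Decidable Q → ℕ
  weight Q? = ∑ N (λ k → 𝟙 (Q? (suc k)) * (α ‼ suc k + 1))

  UpwardClosed : ∀ {q} → Pred ℕ q → Set q
  UpwardClosed Q = ∀ {l p} → l ⪰ p → Q p → Q l

  count-<-rank : ∀ {q} {Q : Pred ℕ q} (Q? : Decidable Q) → UpwardClosed Q →
                 ∀ p → 1 ≤ p → p ≤ N → ¬ Q p → count Q? < rank α p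
  count-<-rank {Q = Q} Q? closed p@(suc _) _ p≤N ¬Qp = subst (count Q? <_) (sym (rank≡count p p≤N))
    (∑-mono-< N (λ k _ → 𝟙-mono (below (suc k)) (Q? (suc k)) (suc k ⪰? p)) p≤N
      (subst₂ _<_ (sym (𝟙-no ¬Qp (Q? p))) (sym (𝟙-yes (⪰-refl p) (p ⪰? p))) z<s))
    where
    below : ∀ l → Q l → l ⪰ p
    below l Ql with l ⪰? p
    ... | yes l⪰p = l⪰p
    ... | no  l⋡p = ⊥-elim (¬Qp (closed (≻⇒⪰ (¬⪰⇒≻ l⋡p)) Ql))

  rank-mono-≤ : ∀ {p q} → p ≤ N → q ≤ N → p ⪰ q → rank α p ≤ rank α q
  rank-mono-≤ {p} {q} p≤N q≤N p⪰q = subst₂ _≤_ (sym (rank≡count p p≤N)) (sym (rank≡count q q≤N))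
    (∑-mono-≤ N (λ k _ → 𝟙-mono (λ l⪰p → ⪰-trans l⪰p p⪰q) (suc k ⪰? p) (suc k ⪰? q)))

SortsByRank : ∀ {N} → Vec ℕ N → (ℕ → ℕ) → Set
SortsByRank {N} α w = ∀ i → 1 ≤ i → i ≤ N → (1 ≤ w i) × (w i ≤ N) × (rank α (w i) ≡ i)

module Sorted {N : ℕ} (α : Vec ℕ N) (w : ℕ → ℕ) (sorts : SortsByRank α w) where
  open PositionOrder α

  w≤N : ∀ {i} → 1 ≤ i → i ≤ N → w i ≤ N
  w≤N 1≤i i≤N = proj₁ (proj₂ (sorts _ 1≤i i≤N))

  rank-w : ∀ {i} → 1 ≤ i → i ≤ N → rank α (w i) ≡ i
  rank-w 1≤i i≤N = proj₂ (proj₂ (sorts _ 1≤i i≤N))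

  w-injective : ∀ {i j} → 1 ≤ i → i ≤ N → 1 ≤ j → j ≤ N → w i ≡ w j → i ≡ j
  w-injective 1≤i i≤N 1≤j j≤N wi≡wj = trans (sym (rank-w 1≤i i≤N)) (trans (cong (rank α) wi≡wj) (rank-w 1≤j j≤N))

  w-≻ : ∀ {i j} → 1 ≤ i → i < j → j ≤ N → w i ≻ w j
  w-≻ {i} {j} 1≤i i<j j≤N with w i ≻? w j
  ... | yes wi≻wj = wi≻wj
  ... | no  wi⊁wj = ⊥-elim (<⇒≱ i<j (begin
    j              ≡⟨ rank-w 1≤j j≤N ⟨
    rank α (w j)   ≤⟨ rank-mono-≤ (w≤N 1≤j j≤N) (w≤N 1≤i i≤N) (¬≻⇒⪰ wi⊁wj) ⟩
    rank α (w i)   ≡⟨ rank-w 1≤i i≤N ⟩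
    i              ∎))
    where
    open ≤-Reasoning
    1≤j = ≤-trans 1≤i (<⇒≤ i<j)
    i≤N = ≤-trans (<⇒≤ i<j) j≤N

  w-entry-antitone : ∀ {i j} → 1 ≤ i → i ≤ j → j ≤ N → α ‼ w j ≤ α ‼ w i
  w-entry-antitone 1≤i i≤j j≤N with m≤n⇒m<n∨m≡n i≤j
  ... | inj₁ i<j  = ⪰-entry (≻⇒⪰ (w-≻ 1≤i i<j j≤N))
  ... | inj₂ refl = ≤-refl

  upwardClosed-w : ∀ {q} {Q : Pred ℕ q} (Q? : Decidable Q) → UpwardClosed Q →
                   ∀ {t} → 1 ≤ t → t ≤ N → t ≤ count Q? → Q (w t)
  upwardClosed-w Q? closed {t} 1≤t t≤N t≤count with Q? (w t)
  ... | yes Qwt = Qwt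
  ... | no ¬Qwt = ⊥-elim (<⇒≱ (subst (count Q? <_) (rank-w 1≤t t≤N)
                                 (count-<-rank Q? closed (w t) (proj₁ (sorts t 1≤t t≤N)) (w≤N 1≤t t≤N) ¬Qwt)) t≤count)

  upwardClosed-weight : ∀ {q} {Q : Pred ℕ q} (Q? : Decidable Q) → UpwardClosed Q →
                        ∀ {K} → (∀ {l} → Q l → K ≤ α ‼ l + 1) →
                        ∀ {t} → 1 ≤ t → t ≤ N → Q (w t) →
                        t * (α ‼ w t + 1) + count Q? * K ≤ weight Q? + t * K
  upwardClosed-weight {Q = Q} Q? closed {K} Q⇒K {t} 1≤t t≤N Qwt = begin
    t * V + count Q? * K
      ≡⟨ cong₂ _+_ (trans (∑-*ʳ N above V) (cong (_* V) t≡)) (∑-*ʳ N (𝟙 ∘ Q? ∘ suc) K) ⟨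
    ∑ N (λ k → above k * V) + ∑ N (λ k → 𝟙 (Q? (suc k)) * K)
      ≡⟨ ∑-+ N _ _ ⟨
    ∑ N (λ k → above k * V + 𝟙 (Q? (suc k)) * K)
      ≤⟨ ∑-mono-≤ N (λ k _ → pointwise (suc k)) ⟩
    ∑ N (λ k → 𝟙 (Q? (suc k)) * (α ‼ suc k + 1) + above k * K)
      ≡⟨ ∑-+ N _ _ ⟩
    ∑ N (λ k → 𝟙 (Q? (suc k)) * (α ‼ suc k + 1)) + ∑ N (λ k → above k * K)
      ≡⟨ cong (∑ N (λ k → 𝟙 (Q? (suc k)) * (α ‼ suc k + 1)) +_) (trans (∑-*ʳ N above K) (cong (_* K) t≡)) ⟩
    weight Q? + t * K ∎
    where
    open ≤-Reasoning
    V = α ‼ w t + 1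
    above : ℕ → ℕ
    above k = 𝟙 (suc k ⪰? w t)
    t≡ : ∑ N above ≡ t
    t≡ = trans (sym (rank≡count (w t) (w≤N 1≤t t≤N))) (rank-w 1≤t t≤N)
    -- Positions above w t weigh at least α_{w t} + 1, every position of Q at least K.
    pointwise : ∀ l → 𝟙 (l ⪰? w t) * V + 𝟙 (Q? l) * K ≤ 𝟙 (Q? l) * (α ‼ l + 1) + 𝟙 (l ⪰? w t) * K
    pointwise l with l ⪰? w t | Q? l
    ... | yes l⪰wt | yes _   = +-monoˡ-≤ (1 * K) (*-monoʳ-≤ 1 (+-monoˡ-≤ 1 (⪰-entry l⪰wt)))
    ... | yes l⪰wt | no ¬Ql  = ⊥-elim (¬Ql (closed l⪰wt Qwt))
    ... | no _     | yes Ql  = subst₂ _≤_ (sym (+-identityʳ K)) (sym (trans (+-identityʳ _) (+-identityʳ _))) (Q⇒K Ql)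
    ... | no _     | no _    = z≤n

module Setting {N : ℕ} (α : Vec ℕ N) (N≡ℓ+∣α∣ : N ≡ ℓ α + ∣ α ∣) (w : ℕ → ℕ) (sorts : SortsByRank α w)
                (n : ℕ) (1≤n : 1 ≤ n) (n≤M : n ≤ α ‼ w 1) where

  open PositionOrder α
  open Sorted α w sorts

  A : ℕ → ℕ
  A = α ‼_

  M : ℕ
  M = A (w 1)

  m′ : ℕ
  m′ = leg α (w 1) (M + 1 ∸ n)

  m : ℕ
  m = suc m′

  K : ℕ
  K = suc (M ∸ n)

  1≤w1 : 1 ≤ w 1
  1≤w1 = proj₁ (‼-pos⇒inRange α (w 1) (≤-trans 1≤n n≤M))

  w1≤N : w 1 ≤ N
  w1≤N = proj₂ (‼-pos⇒inRange α (w 1) (≤-trans 1≤n n≤M))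

  -- Close l says α̃_l + n > α̃_{w 1}.
  Close : ℕ → Set
  Close l = M < A l + n ⊎ (M ≡ A l + n × l < w 1)

  close? : Decidable Close
  close? l = (M <? A l + n) ⊎-dec ((M ≟ A l + n) ×-dec (l <? w 1))

  close-upward : UpwardClosed Close
  close-upward (inj₁ p<l)         (inj₁ M<p)            = inj₁ (<-trans M<p (+-monoˡ-< n p<l))
  close-upward (inj₁ p<l)         (inj₂ (M≡p+n , _))    = inj₁ (subst (_< _) (sym M≡p+n) (+-monoˡ-< n p<l))
  close-upward (inj₂ (l≡p , _))   (inj₁ M<p)            = inj₁ (subst (λ a → M < a + n) (sym l≡p) M<p)
  close-upward (inj₂ (l≡p , l≤p)) (inj₂ (M≡p+n , p<w1)) = inj₂ (trans M≡p+n (cong (_+ n) (sym l≡p)) , ≤-<-trans l≤p p<w1)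

  threshold : ∀ {x} → M + 1 ∸ n ≤ x → M + 1 ≤ x + n
  threshold {x} le = subst (_≤ x + n) (m∸n+n≡m (≤-trans n≤M (m≤m+n M 1))) (+-monoˡ-≤ n le)

  m≤count : m ≤ count close?
  m≤count = begin
    suc (L₁ + L₂)    ≡⟨ cong suc (+-comm L₁ L₂) ⟩
    suc (L₂ + L₁)    ≡⟨ +-suc L₂ L₁ ⟨
    L₂ + (1 + L₁)    ≤⟨ +-mono-≤ before (+-mono-≤ at after) ⟩
    ∑ (w 1 ∸ 1) (𝟙 ∘ close? ∘ suc) + (𝟙 (close? (w 1)) + ∑ (N ∸ w 1) (λ k → 𝟙 (close? (suc (w 1) + k))))
                     ≡⟨ count-splitAt close? 1≤w1 w1≤N ⟨
    count close?     ∎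
    where
    open ≤-Reasoning
    j₀ = M + 1 ∸ n
    right? : Decidable (λ l → j₀ ≤ A l × A l ≤ M)
    right? l = (j₀ ≤? A l) ×-dec (A l ≤? M)
    left? : Decidable (λ l → j₀ ≤ suc (A l) × suc (A l) ≤ M)
    left? l = (j₀ ≤? suc (A l)) ×-dec (suc (A l) ≤? M)
    L₁ = length (filter right? [ suc (w 1) ⋯ N ])
    L₂ = length (filter left? [ 1 ⋯ w 1 ∸ 1 ])
    at : 1 ≤ 𝟙 (close? (w 1))
    at = ≤-reflexive (sym (𝟙-yes (inj₁ (m<m+n M 1≤n)) (close? (w 1))))
    after : L₁ ≤ ∑ (N ∸ w 1) (λ k → 𝟙 (close? (suc (w 1) + k)))
    after = subst (_≤ ∑ (N ∸ w 1) (λ k → 𝟙 (close? (suc (w 1) + k))))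
      (sym (length-filter-applyUpTo right? (λ k → suc (w 1) + k) (N ∸ w 1)))
      (∑-mono-≤ (N ∸ w 1) (λ k _ → 𝟙-mono close-right (right? (suc (w 1) + k)) (close? (suc (w 1) + k))))
      where
      close-right : ∀ {l} → j₀ ≤ A l × A l ≤ M → Close l
      close-right {l} (j₀≤Al , _) = inj₁ (subst (_≤ A l + n) (+-comm M 1) (threshold j₀≤Al))
    before : L₂ ≤ ∑ (w 1 ∸ 1) (𝟙 ∘ close? ∘ suc)
    before = subst (_≤ ∑ (w 1 ∸ 1) (𝟙 ∘ close? ∘ suc)) (sym (length-filter-applyUpTo left? suc (w 1 ∸ 1)))
      (∑-mono-≤ (w 1 ∸ 1) (λ k k<w1-1 → 𝟙-mono (close-left (<pred⇒suc< k<w1-1) ∘ proj₁) (left? (suc k)) (close? (suc k))))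
      where
      <pred⇒suc< : ∀ {k p} → k < p ∸ 1 → suc k < p
      <pred⇒suc< {p = suc _} k<p-1 = s<s k<p-1
      close-left : ∀ {l} → l < w 1 → j₀ ≤ suc (A l) → Close l
      close-left {l} l<w1 j₀≤1+Al with m≤n⇒m<n∨m≡n (threshold j₀≤1+Al)
      ... | inj₁ M+1<Al+1+n = inj₁ (s≤s⁻¹ (subst (_< suc (A l) + n) (+-comm M 1) M+1<Al+1+n))
      ... | inj₂ M+1≡Al+1+n = inj₂ (suc-injective (trans (+-comm 1 M) M+1≡Al+1+n) , l<w1)

  m≤N : m ≤ N
  m≤N = ≤-trans m≤count (count≤N close?)

  close-w : ∀ {t} → 1 ≤ t → t ≤ m → Close (w t)
  close-w 1≤t t≤m = upwardClosed-w close? close-upward 1≤t (≤-trans t≤m m≤N) (≤-trans t≤m m≤count)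

  close⇒≤ℓ : ∀ {l} → 1 ≤ l → l ≤ N → Close l → l ≤ ℓ α
  close⇒≤ℓ {l} 1≤l l≤N (inj₁ M<Al+n) = ‼-pos⇒≤ℓ α 1≤l l≤N (≰⇒> Al≢0)
    where
    Al≢0 : ¬ A l ≤ 0
    Al≢0 Al≤0 = <⇒≱ (subst (λ a → M < a + n) (n≤0⇒n≡0 Al≤0) M<Al+n) n≤M
  close⇒≤ℓ {l} _ _ (inj₂ (_ , l<w1)) = ≤-trans (<⇒≤ l<w1) (‼-pos⇒≤ℓ α 1≤w1 w1≤N (≤-trans 1≤n n≤M))

  close⇒K≤ : ∀ {l} → Close l → K ≤ A l + 1
  close⇒K≤ {l} close = subst (K ≤_) (+-comm 1 (A l)) (s≤s (m≤n+o⇒m∸n≤o M n (subst (M ≤_) (+-comm (A l) n) (M≤ close))))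
    where
    M≤ : Close l → M ≤ A l + n
    M≤ (inj₁ M<Al+n)       = <⇒≤ M<Al+n
    M≤ (inj₂ (M≡Al+n , _)) = ≤-reflexive M≡Al+n

  weight-close≤N : weight close? ≤ N
  weight-close≤N = begin
    ∑ N (λ k → 𝟙 (close? (suc k)) * (A (suc k) + 1))   ≤⟨ ∑-mono-≤ N (λ k k<N → pointwise k<N) ⟩
    ∑ N (λ k → 𝟙 (suc k ≤? ℓ α) + A (suc k))           ≡⟨ ∑-+ N _ _ ⟩
    ∑ N (λ k → 𝟙 (suc k ≤? ℓ α)) + ∑ N (A ∘ suc)      ≤⟨ +-mono-≤ (∑𝟙[1+k≤L]≤L N (ℓ α)) (≤-reflexive (sym (∣∣≡∑ α))) ⟩
    ℓ α + ∣ α ∣                                        ≡⟨ N≡ℓ+∣α∣ ⟨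
    N                                                  ∎
    where
    open ≤-Reasoning
    pointwise : ∀ {k} → k < N → 𝟙 (close? (suc k)) * (A (suc k) + 1) ≤ 𝟙 (suc k ≤? ℓ α) + A (suc k)
    pointwise {k} k<N with close? (suc k)
    ... | no _      = z≤n
    ... | yes close = ≤-reflexive (begin-equality
      1 * (A (suc k) + 1)          ≡⟨ *-identityˡ _ ⟩
      A (suc k) + 1                ≡⟨ +-comm (A (suc k)) 1 ⟩
      1 + A (suc k)                ≡⟨ cong (_+ A (suc k)) (𝟙-yes (close⇒≤ℓ (s≤s z≤n) k<N close) (suc k ≤? ℓ α)) ⟨
      𝟙 (suc k ≤? ℓ α) + A (suc k) ∎)

  weight-bound : ∀ {t b} → 1 ≤ t → t + b ≡ m → t * (A (w t) + 1) + b * K ≤ N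
  weight-bound {t} {b} 1≤t t+b≡m = +-cancelʳ-≤ (t * K) _ _ (begin
    t * V + b * K + t * K        ≡⟨ regroup (t * V) b t K ⟩
    t * V + (t + b) * K          ≡⟨ cong (λ x → t * V + x * K) t+b≡m ⟩
    t * V + m * K                ≤⟨ +-monoʳ-≤ (t * V) (*-monoˡ-≤ K m≤count) ⟩
    t * V + count close? * K     ≤⟨ upwardClosed-weight close? close-upward close⇒K≤ 1≤t t≤N (close-w 1≤t t≤m) ⟩
    weight close? + t * K        ≤⟨ +-monoˡ-≤ (t * K) weight-close≤N ⟩
    N + t * K                    ∎)
    where
    open ≤-Reasoning
    V = A (w t) + 1
    t≤m : t ≤ m
    t≤m = subst (t ≤_) t+b≡m (m≤m+n t b)
    t≤N : t ≤ N
    t≤N = ≤-trans t≤m m≤N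
    regroup : ∀ x b t K → x + b * K + t * K ≡ x + (t + b) * K
    regroup = ℕ-Solver.solve-∀

  m<N : m < N
  m<N = begin
    2 + m′                  ≤⟨ +-mono-≤ (+-monoˡ-≤ 1 (≤-trans 1≤n n≤M)) (m≤m*n m′ K) ⟩
    M + 1 + m′ * K          ≡⟨ cong (_+ m′ * K) (*-identityˡ (M + 1)) ⟨
    1 * (M + 1) + m′ * K    ≤⟨ weight-bound ≤-refl refl ⟩
    N                       ∎
    where open ≤-Reasoning

  last-entry-bound : A (w (suc (N % m))) < n * (N / m)
  last-entry-bound = quotient-bound {q = N / m} {r = r} {b = b} 1≤n (w-entry-antitone ≤-refl (s≤s z≤n) t≤N)
    (subst (suc r * (A (w (suc r)) + 1) + b * K ≤_) N≡ (weight-bound (s≤s z≤n) t+b≡m))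
    where
    r = N % m
    b = m ∸ suc r
    t≤m : suc r ≤ m
    t≤m = m%n<n N m
    t≤N : suc r ≤ N
    t≤N = ≤-trans t≤m m≤N
    t+b≡m : suc r + b ≡ m
    t+b≡m = m+[n∸m]≡n t≤m
    N≡ : N ≡ r + N / m * (suc r + b)
    N≡ = trans (m≡m%n+[m/n]*n N m) (cong (λ x → r + N / m * x) (sym t+b≡m))

  ξ′ : ℕ → ℚ.ℚ
  ξ′ = ξ α w n m′

  -- ξ′ (suc j) unfolds to ξ-at (suc (j % m)) (j / m). The index arithmetic below is done on ξ-Lex,
  -- a statement about naturals: rewriting inside ξ-at makes Agda normalise rationals.
  ξ-at : ℕ → ℕ → ℚ.ℚ
  ξ-at i k = α̃ α (w i) ℚ.- ℕ→ℚ (n * k)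

  ξ-Lex : ℕ → ℕ → ℕ → ℕ → Set
  ξ-Lex i k i′ k′ = A (w i) + n * k′ < A (w i′) + n * k ⊎ (A (w i) + n * k′ ≡ A (w i′) + n * k × w i′ < w i)

  ξ-at-< : ∀ {i k i′ k′} → 1 ≤ i′ → i′ ≤ N → ξ-Lex i k i′ k′ → ξ-at i k ℚ.< ξ-at i′ k′
  ξ-at-< {i} {k} {i′} {k′} 1≤i′ i′≤N = perturbed-< N (A (w i)) (w i) (n * k) (A (w i′)) (w i′) (n * k′) (w≤N 1≤i′ i′≤N)

  ξ-Lex-within-block : ∀ r k → suc r < m → ξ-Lex (suc (suc r)) k (suc r) k
  ξ-Lex-within-block r k r+1<m = lex-+ʳ (n * k) (w-≻ (s≤s z≤n) ≤-refl (≤-trans r+1<m m≤N))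

  ξ-Lex-across-blocks : ∀ k → ξ-Lex 1 (suc k) m k
  ξ-Lex-across-blocks k = subst (λ a → M + n * k < a ⊎ (M + n * k ≡ a × w m < w 1)) shift
    (lex-+ʳ (n * k) (close-w (s≤s z≤n) ≤-refl))
    where
    shift : A (w m) + n + n * k ≡ A (w m) + n * suc k
    shift = trans (+-assoc (A (w m)) n (n * k)) (cong (A (w m) +_) (sym (*-suc n k)))

  ξ-Lex-step : ∀ j → ξ-Lex (suc (suc j % m)) (suc j / m) (suc (j % m)) (j / m)
  ξ-Lex-step j with m≤n⇒m<n∨m≡n (m%n<n j m)
  ... | inj₁ inner = subst₂ (λ r k → ξ-Lex (suc r) k (suc (j % m)) (j / m)) {suc (j % m)} {suc j % m} {j / m} {suc j / m}
                       (sym (proj₁ step)) (sym (proj₂ step)) (ξ-Lex-within-block (j % m) (j / m) inner)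
    where step = suc-%-/-inner j inner
  ... | inj₂ wrap  = subst₂ (λ r k → ξ-Lex (suc r) k (suc (j % m)) (j / m)) {0} {suc j % m} {suc (j / m)} {suc j / m}
                       (sym (proj₁ step)) (sym (proj₂ step))
                       (subst (λ i → ξ-Lex 1 (suc (j / m)) i (j / m)) {m} {suc (j % m)} (sym wrap) (ξ-Lex-across-blocks (j / m)))
    where step = suc-%-/-wrap j wrap

  ξ-decreasing : ∀ i → 1 ≤ i → i < N → ξ′ (suc i) ℚ.< ξ′ i
  ξ-decreasing (suc j) _ _ = ξ-at-< (s≤s z≤n) (≤-trans (m%n<n j m) m≤N) (ξ-Lex-step j)

  ξ-last : ξ′ (suc N) ℚ.< α̃ α (w N)
  ξ-last = subst (ξ′ (suc N) ℚ.<_) (ℚ.+-identityʳ (α̃ α (w N)))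
    (perturbed-< N (A x) x (n * (N / m)) (A (w N)) (w N) 0 (w≤N N≥1 ≤-refl)
      (inj₁ (subst (_< A (w N) + n * (N / m)) (sym (+-identityʳ (A x))) (<-≤-trans last-entry-bound (m≤n+m _ (A (w N)))))))
    where
    x = w (suc (N % m))
    N≥1 = ≤-trans (s≤s z≤n) m≤N

  α̃∘w≢ξ : ∀ s → 1 ≤ s → m + s ≤ N → α̃ α (w (m + s)) ≢ ξ′ (m + s + 1)
  α̃∘w≢ξ s 1≤s m+s≤N α̃≡ξ = <-irrefl (sym same-index) (≤-<-trans i≤m (m<m+n m 1≤s))
    where
    i = suc ((m + s + 1 ∸ 1) % m)
    i≤m : i ≤ m
    i≤m = m%n<n (m + s + 1 ∸ 1) m
    1≤m+s = ≤-trans 1≤s (m≤n+m s m)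
    same-index : m + s ≡ i
    same-index = w-injective 1≤m+s m+s≤N (s≤s z≤n) (≤-trans i≤m m≤N)
      (perturbed-injective N (A (w (m + s))) (w (m + s)) 0 (A (w i)) (w i) (n * ((m + s + 1 ∸ 1) / m))
        (w≤N 1≤m+s m+s≤N) (w≤N (s≤s z≤n) (≤-trans i≤m m≤N)) (trans (ℚ.+-identityʳ (α̃ α (w (m + s)))) α̃≡ξ))

  ξ-eventually-below : ∀ j → N ≤ j → 1 ≤ j → j ≤ N → ξ′ (suc j) ℚ.< α̃ α (w j)
  ξ-eventually-below j N≤j _ j≤N = subst (λ x → ξ′ (suc x) ℚ.< α̃ α (w x)) (≤-antisym N≤j j≤N) ξ-last

  m+∸ : ∀ {s} → s ≤ N ∸ m → m + s ≤ N
  m+∸ s≤N∸m = ≤-trans (+-monoʳ-≤ m s≤N∸m) (≤-reflexive (m+[n∸m]≡n m≤N))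

  unique-crossing :
    Σ ℕ λ T → ((1 ≤ T) × (m + T ≤ N)
                × (∀ s → 1 ≤ s → s < T → α̃ α (w (m + s)) ℚ.< ξ′ (m + s + 1))
                × (ξ′ (m + T + 1) ℚ.< α̃ α (w (m + T))))
            × (∀ T′ → (1 ≤ T′) × (m + T′ ≤ N)
                        × (∀ s → 1 ≤ s → s < T′ → α̃ α (w (m + s)) ℚ.< ξ′ (m + s + 1))
                        × (ξ′ (m + T′ + 1) ℚ.< α̃ α (w (m + T′)))
                      → T′ ≡ T)
  unique-crossing =
    let T , (1≤T , T≤N∸m , below , crossT) , unique =
          first-crossing ℚ.<-cmp (λ s → α̃ α (w (m + s))) (λ s → ξ′ (m + s + 1)) (m<n⇒0<n∸m m<N)
            crossed-at-end (λ s 1≤s s≤N∸m → α̃∘w≢ξ s 1≤s (m+∸ s≤N∸m))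
    in T , (1≤T , m+∸ T≤N∸m , below , crossT) , λ T′ (1≤T′ , _ , below′ , crossT′) → unique T′ 1≤T′ below′ crossT′
    where
    crossed-at-end : ξ′ (m + (N ∸ m) + 1) ℚ.< α̃ α (w (m + (N ∸ m)))
    crossed-at-end = subst (λ x → ξ′ (x + 1) ℚ.< α̃ α (w x)) (sym (m+[n∸m]≡n m≤N))
                       (subst (λ x → ξ′ x ℚ.< α̃ α (w N)) (+-comm 1 N) ξ-last)

mainTheorem5 :
    (N : ℕ) (α : Vec ℕ N) → N ≡ ℓ α + ∣ α ∣ →
    (w : ℕ → ℕ) →
    (∀ i → 1 ≤ i → i ≤ N → (1 ≤ w i) × (w i ≤ N) × (rank α (w i) ≡ i)) →
    (n : ℕ) → 1 ≤ n → n ≤ α ‼ w 1 →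
    let m' = leg α (w 1) (α ‼ w 1 + 1 ∸ n)
        m = suc m'
        ξ′ = ξ α w n m'
    in (∀ i → 1 ≤ i → i < N → ξ′ (suc i) ℚ.< ξ′ i)
       × (∃ λ J → (J ≤ N) × (∀ j → J ≤ j → 1 ≤ j → j ≤ N → ξ′ (suc j) ℚ.< α̃ α (w j)))
       × (Σ ℕ λ T →
            ((1 ≤ T) × (m + T ≤ N)
              × (∀ s → 1 ≤ s → s < T → α̃ α (w (m + s)) ℚ.< ξ′ (m + s + 1))
              × (ξ′ (m + T + 1) ℚ.< α̃ α (w (m + T))))
            × (∀ T′ → (1 ≤ T′) × (m + T′ ≤ N)
                        × (∀ s → 1 ≤ s → s < T′ → α̃ α (w (m + s)) ℚ.< ξ′ (m + s + 1))
                        × (ξ′ (m + T′ + 1) ℚ.< α̃ α (w (m + T′)))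
                      → T′ ≡ T))
       × (∀ s → 1 ≤ s → m + s ≤ N → α̃ α (w (m + s)) ≢ ξ′ (m + s + 1))
mainTheorem5 N α N≡ℓ+∣α∣ w sorts n 1≤n n≤M =
  ξ-decreasing , (N , ≤-refl , ξ-eventually-below) , unique-crossing , α̃∘w≢ξ
  where open Setting α N≡ℓ+∣α∣ w sorts n 1≤n n≤M
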